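{- If $S\subseteq\mathbb{N}^{\mathbb{N}}$ is guessable, then $S$ is defined by some sentence $\exists x\,\forall y\,\phi$ and also by some sentence $\forall x\,\exists y\,\psi$ of $\mathscr{L}_{\max}$, where $\phi$ and $\psi$ are quantifier-free.
   Context: $\mathbb{N}^{<\mathbb{N}}$ is the set of finite sequences of naturals. A function $G:\mathbb{N}^{<\mathbb{N}}\to\{0,1\}$ guesses $S\subseteq\mathbb{N}^{\mathbb{N}}$ if for every $f:\mathbb{N}\to\mathbb{N}$ there is $m>0$ such that for all $n>m$, $G(f(0),\ldots,f(n))$ equals $1$ if $f\in S$ and $0$ if $f\notin S$; $S$ is guessable if it has a guesser. The language $\mathscr{L}_{\max}$ consists of: equality, connectives and quantifiers; a constant symbol $\mathbf{n}$ for each $n\in\mathbb{N}$; an $n$-ary function symbol $\tilde w$ for each $w:\mathbb{N}^n\to\mathbb{N}$ ($n>0$); an $n$-ary predicate symbol $\tilde p$ for each $p\subseteq\mathbb{N}^n$ ($n>0$); an "$\mathbb{N}^{<\mathbb{N}}$-ary" function symbol $\tilde G$ for each $G:\mathbb{N}^{<\mathbb{N}}\to\mathbb{N}$; a unary function symbol $\mathbf{f}$; and a symbol $\cdots_x$ for each variable $x$. Terms: variables; constants; $h(t_1,\ldots,t_n)$ for an $n$-ary or $\mathbb{N}^{<\mathbb{N}}$-ary symbol $h$; and, for $\mathbb{N}^{<\mathbb{N}}$-ary $G$, terms $u,v$, variable $x$, the term $G(u(\mathbf{0}),\cdots_x,u(v))$ with free variables $(FV(u)\setminus\{x\})\cup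 FV(v)$. Formulas as in first-order logic. For $f:\mathbb{N}\to\mathbb{N}$, $\mathscr{M}_f$ has universe $\mathbb{N}$ and interprets $\mathbf n$ as $n$ (numeral $\bar n$), $\tilde w$ as $w$, $\tilde p$ as $p$, $\tilde G$ as $G$, $\mathbf f$ as $f$; terms are evaluated under an assignment $s$ by the usual recursion plus $G(u(\mathbf 0),\cdots_x,u(v))^s=G\big(u(x|\mathbf 0)^s,\ldots,u(x|\overline{v^s})^s\big)$; satisfaction is as usual. A sentence $\phi$ defines $S$ if for every $f:\mathbb{N}\to\mathbb{N}$, $\mathscr{M}_f\models\phi$ iff $f\in S$. -}

module Defs where

open import Data.Nat using (ℕ; zero; suc; _<_; _≟_)
open import Data.Bool using (Bool; true; false)
open import Data.List using (List; []; _∷_; map; upTo)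
open import Data.Vec using (Vec; []; _∷_)
open import Data.Product using (Σ; _×_; _,_)
open import Data.Sum using (_⊎_)
open import Data.Empty using (⊥)
open import Data.Unit using (⊤)
open import Relation.Nullary using (¬_; yes; no)
open import Relation.Binary.PropositionalEquality using (_≡_; _≢_)

-- Guessing.  Subsets of ℕ^ℕ are represented by their characteristic
-- functions (ℕ → ℕ) → Bool (true = 1 = member).

prefix : (ℕ → ℕ) → ℕ → List ℕ
prefix f n = map f (upTo (suc n))

Guesses : (List ℕ → Bool) → ((ℕ → ℕ) → Bool) → Set
Guesses G S = (f : ℕ → ℕ) → Σ ℕ λ m → (0 < m) ×
  ((n : ℕ) → m < n → G (prefix f n) ≡ S f)

Guessable : ((ℕ → ℕ) → Bool) → Set
Guessable S = Σ (List ℕ → Bool) λ G → Guesses G S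

Var : Set
Var = ℕ

data Term : Set where
  var   : Var → Term
  const : ℕ → Term
  fun   : (n : ℕ) → (Vec ℕ (suc n) → ℕ) → Vec Term (suc n) → Term
  gapp  : (List ℕ → ℕ) → List Term → Term
  fsym  : Term → Term
  gdots : (List ℕ → ℕ) → Term → Var → Term → Term         -- gdots G u x v = G(u(𝟎),⋯ₓ,u(v))

data Formula : Set where
  _≐_  : Term → Term → Formula
  rel  : (n : ℕ) → (Vec ℕ (suc n) → Bool) → Vec Term (suc n) → Formula
  ¬'_  : Formula → Formula
  _∧'_ : Formula → Formula → Formula
  _∨'_ : Formula → Formula → Formula
  _⇒'_ : Formula → Formula → Formula
  ∀'   : Var → Formula → Formula
  ∃'   : Var → Formula → Formula

QF : Formula → Set
QF (t ≐ u)    = ⊤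
QF (rel _ _ _) = ⊤
QF (¬' φ)     = QF φ
QF (φ ∧' ψ)   = QF φ × QF ψ
QF (φ ∨' ψ)   = QF φ × QF ψ
QF (φ ⇒' ψ)   = QF φ × QF ψ
QF (∀' _ _)   = ⊥
QF (∃' _ _)   = ⊥

mutual
  FreeT : Var → Term → Set
  FreeT z (var y)         = z ≡ y
  FreeT z (const _)       = ⊥
  FreeT z (fun _ _ ts)    = FreeVec z ts
  FreeT z (gapp _ ts)     = FreeList z ts
  FreeT z (fsym t)        = FreeT z t
  FreeT z (gdots _ u x v) = (FreeT z u × z ≢ x) ⊎ FreeT z v

  FreeVec : ∀ {n} → Var → Vec Term n → Set
  FreeVec z []       = ⊥
  FreeVec z (t ∷ ts) = FreeT z t ⊎ FreeVec z ts

  FreeList : Var → List Term → Set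
  FreeList z []       = ⊥
  FreeList z (t ∷ ts) = FreeT z t ⊎ FreeList z ts

FreeF : Var → Formula → Set
FreeF z (t ≐ u)      = FreeT z t ⊎ FreeT z u
FreeF z (rel _ _ ts) = FreeVec z ts
FreeF z (¬' φ)       = FreeF z φ
FreeF z (φ ∧' ψ)     = FreeF z φ ⊎ FreeF z ψ
FreeF z (φ ∨' ψ)     = FreeF z φ ⊎ FreeF z ψ
FreeF z (φ ⇒' ψ)     = FreeF z φ ⊎ FreeF z ψ
FreeF z (∀' x φ)     = FreeF z φ × z ≢ x
FreeF z (∃' x φ)     = FreeF z φ × z ≢ x

Sentence : Formula → Set
Sentence φ = (z : Var) → ¬ FreeF z φ

Assignment : Set
Assignment = Var → ℕ

_[_↦_] : Assignment → Var → ℕ → Assignment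
(s [ x ↦ a ]) y with y ≟ x
... | yes _ = a
... | no  _ = s y

mutual
  eval : (ℕ → ℕ) → Assignment → Term → ℕ
  eval f s (var y)         = s y
  eval f s (const n)       = n
  eval f s (fun _ w ts)    = w (evalVec f s ts)
  eval f s (gapp G ts)     = G (evalList f s ts)
  eval f s (fsym t)        = f (eval f s t)
  eval f s (gdots G u x v) =
    G (map (λ i → eval f (s [ x ↦ i ]) u) (upTo (suc (eval f s v))))

  evalVec : ∀ {n} → (ℕ → ℕ) → Assignment → Vec Term n → Vec ℕ n
  evalVec f s []       = []
  evalVec f s (t ∷ ts) = eval f s t ∷ evalVec f s ts

  evalList : (ℕ → ℕ) → Assignment → List Term → List ℕ
  evalList f s []       = []
  evalList f s (t ∷ ts) = eval f s t ∷ evalList f s ts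

Sat : (ℕ → ℕ) → Assignment → Formula → Set
Sat f s (t ≐ u)      = eval f s t ≡ eval f s u
Sat f s (rel _ p ts) = p (evalVec f s ts) ≡ true
Sat f s (¬' φ)       = ¬ Sat f s φ
Sat f s (φ ∧' ψ)     = Sat f s φ × Sat f s ψ
Sat f s (φ ∨' ψ)     = Sat f s φ ⊎ Sat f s ψ
Sat f s (φ ⇒' ψ)     = Sat f s φ → Sat f s ψ
Sat f s (∀' x φ)     = (a : ℕ) → Sat f (s [ x ↦ a ]) φ
Sat f s (∃' x φ)     = Σ ℕ λ a → Sat f (s [ x ↦ a ]) φ

-- M_f ⊨ φ for a sentence φ (evaluated under the all-zero assignment;
-- the choice is irrelevant for sentences)
_⊨_ : (ℕ → ℕ) → Formula → Set
f ⊨ φ = Sat f (λ _ → 0) φ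

Defines : Formula → ((ℕ → ℕ) → Bool) → Set
Defines φ S = (f : ℕ → ℕ) → (f ⊨ φ → S f ≡ true) × (S f ≡ true → f ⊨ φ)

module Submission where

-- A guesser G for S is a Boolean sequence n ↦ G(f(0),…,f(n)) that converges
-- to the truth value S f.  For a sequence converging to b, "true from some
-- point on" and "true infinitely often" are both equivalent to b = true.
-- Both statements are Σ₂/Π₂ conditions over the single atomic fact
-- "G(f(0),…,f(y)) = 1", which L_max expresses by the quantifier-free term
-- G(𝐟(𝟎),⋯_z,𝐟(y)) ≐ 𝟏 (the guesser G is coded as an ℕ-valued symbol).
-- Hence S is defined by
--     ∃x ∀y (x < y ⇒ G(𝐟(𝟎),⋯_z,𝐟(y)) ≐ 𝟏)   and
--     ∀x ∃y (x < y ∧ G(𝐟(𝟎),⋯_z,𝐟(y)) ≐ 𝟏).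

open import Defs
open import Data.Nat using (ℕ; suc; _<_; _+_; _<ᵇ_; s≤s)
open import Data.Nat.Properties using (<ᵇ⇒<; <⇒<ᵇ; m≤m+n; m≤n+m)
open import Data.Bool using (Bool; true; false)
open import Data.Bool.Properties using (T-≡)
open import Data.List using (List)
open import Data.Product using (Σ; _×_; _,_)
open import Data.Sum using (_⊎_; inj₁; inj₂)
open import Data.Vec using (Vec; []; _∷_)
open import Data.Unit using (tt)
open import Data.Empty using (⊥-elim)
open import Function using (_∘_; case_of_)
open import Function.Bundles using (_⇔_; mk⇔; Equivalence)
open import Function.Properties.Equivalence using () renaming (trans to ⇔-trans)
open import Relation.Binary.PropositionalEquality using (_≡_; refl; sym; trans; cong)

open Equivalence using (to; from)

ConvergesTo : (ℕ → Bool) → Bool → Set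
ConvergesTo g b = Σ ℕ λ m → (n : ℕ) → m < n → g n ≡ b

EventuallyTrue : (ℕ → Bool) → Set
EventuallyTrue g = Σ ℕ λ a → (n : ℕ) → a < n → g n ≡ true

InfinitelyOftenTrue : (ℕ → Bool) → Set
InfinitelyOftenTrue g = (a : ℕ) → Σ ℕ λ n → a < n × g n ≡ true

commonBound : (a m : ℕ) → Σ ℕ λ n → a < n × m < n
commonBound a m = suc (a + m) , s≤s (m≤m+n a m) , s≤s (m≤n+m m a)

-- The limit of a convergent sequence is true iff the sequence is
-- eventually true: beyond both thresholds the two tails must agree.
eventuallyTrue⇔limit : ∀ {g b} → ConvergesTo g b → EventuallyTrue g ⇔ b ≡ true
eventuallyTrue⇔limit {g} {b} (m , conv) = mk⇔ toLimit fromLimit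
  where
  toLimit : EventuallyTrue g → b ≡ true
  toLimit (a , eventually) with commonBound a m
  ... | n , a<n , m<n = trans (sym (conv n m<n)) (eventually n a<n)

  fromLimit : b ≡ true → EventuallyTrue g
  fromLimit b≡true = m , λ n m<n → trans (conv n m<n) b≡true

-- The limit of a convergent sequence is true iff the sequence is
-- infinitely often true: a true value beyond the threshold is the limit.
infinitelyOftenTrue⇔limit : ∀ {g b} → ConvergesTo g b → InfinitelyOftenTrue g ⇔ b ≡ true
infinitelyOftenTrue⇔limit {g} {b} (m , conv) = mk⇔ toLimit fromLimit
  where
  toLimit : InfinitelyOftenTrue g → b ≡ true
  toLimit often with often m
  ... | n , m<n , gn≡true = trans (sym (conv n m<n)) gn≡true

  fromLimit : b ≡ true → InfinitelyOftenTrue g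
  fromLimit b≡true a with commonBound a m
  ... | n , a<n , m<n = n , a<n , trans (conv n m<n) b≡true

guesses-converge : ∀ {G S} → Guesses G S → (f : ℕ → ℕ) →
  ConvergesTo (λ n → G (prefix f n)) (S f)
guesses-converge guesses f with guesses f
... | m , _ , conv = m , conv

-- Booleans as the values 0/1 of an ℕ-valued function symbol.
bit : Bool → ℕ
bit true  = 1
bit false = 0

bit≡1 : ∀ {b} → bit b ≡ 1 → b ≡ true
bit≡1 {true}  _ = refl
bit≡1 {false} ()

lessThan : Vec ℕ 2 → Bool
lessThan (a ∷ b ∷ []) = a <ᵇ b

_<'_ : Var → Var → Formula
x <' y = rel 1 lessThan (var x ∷ var y ∷ [])

-- The atomic formula G(𝐟(𝟎),⋯₂,𝐟(y)) ≐ 𝟏, i.e. "G guesses 1 at stage y";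
-- the variable 2 is bound by ⋯₂.
guessesOne : (List ℕ → Bool) → Var → Formula
guessesOne G y = gdots (bit ∘ G) (fsym (var 2)) 2 (var y) ≐ const 1

∃∀-matrix : (List ℕ → Bool) → Formula
∃∀-matrix G = (0 <' 1) ⇒' guessesOne G 1

∀∃-matrix : (List ℕ → Bool) → Formula
∀∃-matrix G = (0 <' 1) ∧' guessesOne G 1

FreeAmong : Var → Var → Formula → Set
FreeAmong x y φ = (z : Var) → FreeF z φ → z ≡ x ⊎ z ≡ y

closed-∃∀ : ∀ {x y φ} → FreeAmong x y φ → Sentence (∃' x (∀' y φ))
closed-∃∀ among z ((free , z≢y) , z≢x) with among z free
... | inj₁ z≡x = z≢x z≡x
... | inj₂ z≡y = z≢y z≡y

closed-∀∃ : ∀ {x y φ} → FreeAmong x y φ → Sentence (∀' x (∃' y φ))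
closed-∀∃ among z ((free , z≢y) , z≢x) with among z free
... | inj₁ z≡x = z≢x z≡x
... | inj₂ z≡y = z≢y z≡y

-- Free variables of the two matrices (the same for ⇒' and ∧').
free-matrix : ∀ G z → FreeF z (0 <' 1) ⊎ FreeF z (guessesOne G 1) → z ≡ 0 ⊎ z ≡ 1
free-matrix G z (inj₁ (inj₁ z≡0))                 = inj₁ z≡0
free-matrix G z (inj₁ (inj₂ (inj₁ z≡1)))          = inj₂ z≡1
free-matrix G z (inj₁ (inj₂ (inj₂ ())))
free-matrix G z (inj₂ (inj₁ (inj₁ (z≡2 , z≢2)))) = ⊥-elim (z≢2 z≡2)
free-matrix G z (inj₂ (inj₁ (inj₂ z≡1)))          = inj₂ z≡1
free-matrix G z (inj₂ (inj₂ ()))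

sat-<' : ∀ f s x y → Sat f s (x <' y) ⇔ s x < s y
sat-<' f s x y = mk⇔ (<ᵇ⇒< (s x) (s y) ∘ from T-≡) (to T-≡ ∘ <⇒<ᵇ)

sat-guessesOne : ∀ f s G y → Sat f s (guessesOne G y) ⇔ G (prefix f (s y)) ≡ true
sat-guessesOne f s G y = mk⇔ bit≡1 (cong bit)

assign : ℕ → ℕ → Assignment
assign a n = ((λ _ → 0) [ 0 ↦ a ]) [ 1 ↦ n ]

sat-order : ∀ f a n → Sat f (assign a n) (0 <' 1) ⇔ a < n
sat-order f a n = sat-<' f (assign a n) 0 1

sat-guess : ∀ f G a n → Sat f (assign a n) (guessesOne G 1) ⇔ G (prefix f n) ≡ true
sat-guess f G a n = sat-guessesOne f (assign a n) G 1

sat-∃∀ : ∀ f G → f ⊨ ∃' 0 (∀' 1 (∃∀-matrix G)) ⇔ EventuallyTrue (λ n → G (prefix f n))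
sat-∃∀ f G = mk⇔
  (λ { (a , sat) → a , λ n a<n →
          to (sat-guess f G a n) (sat n (from (sat-order f a n) a<n)) })
  (λ { (a , eventually) → a , λ n a<n →
          from (sat-guess f G a n) (eventually n (to (sat-order f a n) a<n)) })

sat-∀∃ : ∀ f G → f ⊨ ∀' 0 (∃' 1 (∀∃-matrix G)) ⇔ InfinitelyOftenTrue (λ n → G (prefix f n))
sat-∀∃ f G = mk⇔
  (λ sat a → case sat a of λ { (n , a<n , g) →
      n , to (sat-order f a n) a<n , to (sat-guess f G a n) g })
  (λ often a → case often a of λ { (n , a<n , g) →
      n , from (sat-order f a n) a<n , from (sat-guess f G a n) g })

defines : ∀ {θ S} → ((f : ℕ → ℕ) → f ⊨ θ ⇔ S f ≡ true) → Defines θ S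
defines equiv f = to (equiv f) , from (equiv f)

lemma6 : (S : (ℕ → ℕ) → Bool) → Guessable S →
    (Σ Var λ x → Σ Var λ y → Σ Formula λ φ →
       QF φ × Sentence (∃' x (∀' y φ)) × Defines (∃' x (∀' y φ)) S)
    ×
    (Σ Var λ x → Σ Var λ y → Σ Formula λ ψ →
       QF ψ × Sentence (∀' x (∃' y ψ)) × Defines (∀' x (∃' y ψ)) S)
lemma6 S (G , guesses) =
  (0 , 1 , ∃∀-matrix G , (tt , tt) , closed-∃∀ {φ = ∃∀-matrix G} (free-matrix G) , ∃∀-defines) ,
  (0 , 1 , ∀∃-matrix G , (tt , tt) , closed-∀∃ {φ = ∀∃-matrix G} (free-matrix G) , ∀∃-defines)
  where
  converges : (f : ℕ → ℕ) → ConvergesTo (λ n → G (prefix f n)) (S f)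
  converges = guesses-converge {G = G} guesses

  ∃∀-defines : Defines (∃' 0 (∀' 1 (∃∀-matrix G))) S
  ∃∀-defines = defines {θ = ∃' 0 (∀' 1 (∃∀-matrix G))} λ f →
    ⇔-trans (sat-∃∀ f G) (eventuallyTrue⇔limit (converges f))

  ∀∃-defines : Defines (∀' 0 (∃' 1 (∀∃-matrix G))) S
  ∀∃-defines = defines {θ = ∀' 0 (∃' 1 (∀∃-matrix G))} λ f →
    ⇔-trans (sat-∀∃ f G) (infinitelyOftenTrue⇔limit (converges f))
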